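{- Let $\varphi$ be a bigger-is-less Turing functional. Then either there is a sparse by design set $S\subseteq\mathbb{N}$ such that for every function $f:\mathbb{N}\to\mathbb{N}$, $\mathrm{dom}(\varphi^f)\cap S\neq\emptyset$, or there is a function $g:\mathbb{N}\to\mathbb{N}$ such that for every $h\gg g$, $\mathrm{dom}(\varphi^h)=\emptyset$.
   Context: For functions $f,g:\mathbb{N}\to\mathbb{N}$, $g\gg f$ means $g(n)\geq f(n)$ for all $n$. A Turing functional $\varphi$ (taking functions $\mathbb{N}\to\mathbb{N}$ as oracles) only outputs 1's if $\varphi^X(n)\downarrow$ implies $\varphi^X(n)=1$; such a $\varphi$ is bigger-is-less if for all $g,h$ with $h\gg g$, $\mathrm{dom}(\varphi^h)\subseteq\mathrm{dom}(\varphi^g)$. A set $S\subseteq\mathbb{N}$ is sparse by design if for every $n$, $|S\cap[5^n,5^{n+1}-1]|\leq2^{n+1}$. -}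

module Defs where

open import Data.Nat using (ℕ; zero; suc; _+_; _∸_; _^_; _≤_)
open import Data.Bool using (Bool; true; false; if_then_else_)
open import Data.List using (List; map; upTo)
open import Data.Product using (∃)
open import Relation.Binary.PropositionalEquality using (_≡_)

-- A Turing functional that only outputs 1 is determined by its domain.
-- We represent it by its (use-based) set of axioms:
--   φ n σ ≡ true  means: on input n, with oracle answers σ = (X 0, …, X (k-1)),
--   the computation halts (with output 1) having queried only the oracle below k.
Functional : Set
Functional = ℕ → List ℕ → Bool

prefix : (ℕ → ℕ) → ℕ → List ℕ
prefix f k = map f (upTo k)

Dom : Functional → (ℕ → ℕ) → ℕ → Set
Dom φ f n = ∃ λ k → φ n (prefix f k) ≡ true

_≫_ : (ℕ → ℕ) → (ℕ → ℕ) → Set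
g ≫ f = ∀ n → f n ≤ g n

BiggerIsLess : Functional → Set
BiggerIsLess φ = ∀ g h → h ≫ g → ∀ n → Dom φ h n → Dom φ g n

countFrom : (ℕ → Bool) → ℕ → ℕ → ℕ
countFrom S a zero = 0
countFrom S a (suc l) = (if S a then 1 else 0) + countFrom S (suc a) l

SparseByDesign : (ℕ → Bool) → Set
SparseByDesign S = ∀ n → countFrom S (5 ^ n) (5 ^ suc n ∸ 5 ^ n) ≤ 2 ^ suc n

module Submission where

-- Call a pair (s, k) of a bound s : ℕ → ℕ and a length k a node; an input n
-- is forced by it if n ∈ dom φ^g for every g lying below s on the first k arguments.
-- Since φ is bigger-is-less, every halting computation φ^f(n) forces n at the node
-- (f, k) given by its use k.  A node is terminal if it forces nothing, yet for every
-- height c it forces some input once g k ≤ c is required as well.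
--
-- Excluding the two easy cases (some g all of whose majorants have empty domain:
-- second alternative; some n in every domain: take S = {n}), every f lies below a
-- terminal node: otherwise one raises f step by step, keeping every node unforced, to
-- a limit function whose (nonempty) domain contains a forced input.  Coding nodes
-- together with a lower bound b on the height by numbers t, we pick for each t an
-- input target t > 5 · target (t-1) forced by every terminal node coded by t at some
-- height ≥ b; this is possible because a terminal node forces infinitely many inputs.
-- The range S of target meets every block [5^n, 5^(n+1)) at most once, so it is sparse by
-- design, and f meets S at the input served for the node below f with b = f k.

open import Defs
open import Level using (0ℓ)
open import Axiom.ExcludedMiddle using (ExcludedMiddle)
open import Data.Nat using (ℕ)
open import Data.Bool using (Bool; true)
open import Data.Product using (Σ; ∃; _×_)
open import Data.Sum using (_⊎_)
open import Relation.Nullary using (¬_)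
open import Relation.Binary.PropositionalEquality using (_≡_)

open import Axiom.DoubleNegationElimination using (em⇒dne)
open import Data.Nat using (zero; suc; _+_; _*_; _∸_; _^_; _≤_; _<_; z≤n; s≤s; _⊔_; _<?_)
open import Data.Nat.Properties
open import Data.Bool using (false)
open import Data.List using (List; []; _∷_; applyUpTo)
open import Data.List.Properties using (map-upTo; ∷-injective)
open import Data.Product using (_,_; proj₁; proj₂)
open import Data.Sum using (inj₁; inj₂)
open import Function using (_∘_)
open import Relation.Nullary using (Dec; yes; no; contradiction)
open import Relation.Nullary.Decidable using (isYes)
open import Relation.Binary.Definitions using (tri<; tri≈; tri>)
open import Relation.Binary.PropositionalEquality using (refl; sym; trans; cong; cong₂; subst)

AgreeBelow : ℕ → (ℕ → ℕ) → (ℕ → ℕ) → Set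
AgreeBelow k f h = ∀ i → i < k → f i ≡ h i

Bounded : (ℕ → ℕ) → ℕ → (ℕ → ℕ) → Set
Bounded s k g = ∀ i → i < k → g i ≤ s i

bounded-transfer : ∀ {s s' k g} → AgreeBelow k s s' → Bounded s k g → Bounded s' k g
bounded-transfer {g = g} s≡s' g≤s i i<k = subst (g i ≤_) (s≡s' i i<k) (g≤s i i<k)

splice : (ℕ → ℕ) → ℕ → (ℕ → ℕ) → ℕ → ℕ
splice f k g i with i <? k
... | yes _ = f i
... | no _ = g i

splice-agree : ∀ f k g → AgreeBelow k f (splice f k g)
splice-agree f k g i i<k with i <? k
... | yes _ = refl
... | no i≮k = contradiction i<k i≮k

splice-beyond : ∀ f k g i → k ≤ i → splice f k g i ≡ g i
splice-beyond f k g i k≤i with i <? k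
... | yes i<k = contradiction k≤i (<⇒≱ i<k)
... | no _ = refl

splice-majorant : ∀ f k g → Bounded f k g → splice f k g ≫ g
splice-majorant f k g g≤f i with i <? k
... | yes i<k = g≤f i i<k
... | no _ = ≤-refl

applyUpTo-cong : ∀ (f h : ℕ → ℕ) k → AgreeBelow k f h → applyUpTo f k ≡ applyUpTo h k
applyUpTo-cong f h zero f≡h = refl
applyUpTo-cong f h (suc k) f≡h =
  cong₂ _∷_ (f≡h 0 (s≤s z≤n)) (applyUpTo-cong (f ∘ suc) (h ∘ suc) k (λ i i<k → f≡h (suc i) (s≤s i<k)))

applyUpTo-injective : ∀ (f h : ℕ → ℕ) k k' → applyUpTo f k ≡ applyUpTo h k' → k ≡ k' × AgreeBelow k f h
applyUpTo-injective f h zero zero _ = refl , λ i ()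
applyUpTo-injective f h zero (suc k') ()
applyUpTo-injective f h (suc k) zero ()
applyUpTo-injective f h (suc k) (suc k') eq with ∷-injective eq
... | f0≡h0 , tails with applyUpTo-injective (f ∘ suc) (h ∘ suc) k k' tails
...   | refl , agree = refl , λ { zero _ → f0≡h0 ; (suc i) (s≤s i<k) → agree i i<k }

prefix-cong : ∀ f h k → AgreeBelow k f h → prefix f k ≡ prefix h k
prefix-cong f h k f≡h = trans (map-upTo f k) (trans (applyUpTo-cong f h k f≡h) (sym (map-upTo h k)))

prefix-injective : ∀ f h k k' → prefix f k ≡ prefix h k' → k ≡ k' × AgreeBelow k f h
prefix-injective f h k k' eq =
  applyUpTo-injective f h k k' (trans (sym (map-upTo f k)) (trans eq (map-upTo h k')))

-- An injective coding of nodes (b, s, k) by natural numbers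

-- pairCode a x = 2^a · (2x + 1)
pairCode : ℕ → ℕ → ℕ
pairCode zero x = suc (2 * x)
pairCode (suc a) x = 2 * pairCode a x

pairCode-injective : ∀ a x a' x' → pairCode a x ≡ pairCode a' x' → a ≡ a' × x ≡ x'
pairCode-injective zero x zero x' eq = refl , *-cancelˡ-≡ x x' 2 (suc-injective eq)
pairCode-injective zero x (suc a') x' eq = contradiction (sym eq) (even≢odd (pairCode a' x') x)
pairCode-injective (suc a) x zero x' eq = contradiction eq (even≢odd (pairCode a x) x')
pairCode-injective (suc a) x (suc a') x' eq with pairCode-injective a x a' x' (*-cancelˡ-≡ _ _ 2 eq)
... | refl , x≡x' = refl , x≡x'

listCode : List ℕ → ℕ
listCode [] = 0
listCode (a ∷ l) = suc (pairCode a (listCode l))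

listCode-injective : ∀ l l' → listCode l ≡ listCode l' → l ≡ l'
listCode-injective [] [] _ = refl
listCode-injective [] (_ ∷ _) ()
listCode-injective (_ ∷ _) [] ()
listCode-injective (a ∷ l) (a' ∷ l') eq with pairCode-injective a (listCode l) a' (listCode l') (suc-injective eq)
... | refl , codes = cong (a ∷_) (listCode-injective l l' codes)

-- the node (s, k) with a lower bound b for the height at position k
nodeCode : ℕ → (ℕ → ℕ) → ℕ → ℕ
nodeCode b s k = listCode (b ∷ prefix s k)

nodeCode-injective : ∀ b s k b' s' k' → nodeCode b s k ≡ nodeCode b' s' k' →
  b ≡ b' × k ≡ k' × AgreeBelow k s s'
nodeCode-injective b s k b' s' k' eq with ∷-injective (listCode-injective (b ∷ prefix s k) (b' ∷ prefix s' k') eq)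
... | b≡b' , prefixes with prefix-injective s s' k k' prefixes
...   | k≡k' , agree = b≡b' , k≡k' , agree

-- Sparseness

AtMostOneIn : (ℕ → Bool) → ℕ → ℕ → Set
AtMostOneIn S a l = ∀ i j → a ≤ i → i < a + l → a ≤ j → j < a + l → S i ≡ true → S j ≡ true → i ≡ j

inTail : ∀ {a l i} → i < suc a + l → i < a + suc l
inTail {a} {l} {i} = subst (i <_) (sym (+-suc a l))

countFrom-none : ∀ S a l → (∀ i → a ≤ i → i < a + l → S i ≡ false) → countFrom S a l ≡ 0
countFrom-none S a zero _ = refl
countFrom-none S a (suc l) none rewrite none a ≤-refl (m<m+n a (s≤s z≤n)) =
  countFrom-none S (suc a) l (λ i a<i i<end → none i (<⇒≤ a<i) (inTail i<end))

countFrom-atMostOne : ∀ S a l → AtMostOneIn S a l → countFrom S a l ≤ 1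
countFrom-atMostOne S a zero _ = z≤n
countFrom-atMostOne S a (suc l) unique with S a in Sa
... | true = subst (λ rest → suc rest ≤ 1) (sym (countFrom-none S (suc a) l others)) ≤-refl
  where
  others : ∀ i → suc a ≤ i → i < suc a + l → S i ≡ false
  others i a<i i<end with S i in Si
  ... | false = refl
  ... | true = contradiction (unique a i ≤-refl (m<m+n a (s≤s z≤n)) (<⇒≤ a<i) (inTail i<end) Sa Si) (<⇒≢ a<i)
... | false = countFrom-atMostOne S (suc a) l
  (λ i j a<i i<end a<j j<end → unique i j (<⇒≤ a<i) (inTail i<end) (<⇒≤ a<j) (inTail j<end))

SpreadOut : (ℕ → Bool) → Set
SpreadOut S = ∀ i j → S i ≡ true → S j ≡ true → i < j → 5 * i < j

-- a spread-out set has at most one member in each block [5^n, 5^(n+1))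
spreadOut⇒sparse : ∀ S → SpreadOut S → SparseByDesign S
spreadOut⇒sparse S spread n =
  ≤-trans (countFrom-atMostOne S (5 ^ n) (5 ^ suc n ∸ 5 ^ n) oneInBlock) (m^n>0 2 (suc n))
  where
  blockEnd : 5 ^ n + (5 ^ suc n ∸ 5 ^ n) ≡ 5 ^ suc n
  blockEnd = m+[n∸m]≡n (m≤n*m (5 ^ n) 5)
  isolated : ∀ i j → 5 ^ n ≤ i → j < 5 ^ suc n → S i ≡ true → S j ≡ true → ¬ i < j
  isolated i j start≤i j<end Si Sj i<j =
    <-irrefl refl (<-trans (spread i j Si Sj i<j) (<-≤-trans j<end (*-monoʳ-≤ 5 start≤i)))
  oneInBlock : AtMostOneIn S (5 ^ n) (5 ^ suc n ∸ 5 ^ n)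
  oneInBlock i j start≤i i<end start≤j j<end Si Sj with <-cmp i j
  ... | tri< i<j _ _ = contradiction i<j (isolated i j start≤i (subst (j <_) blockEnd j<end) Si Sj)
  ... | tri≈ _ i≡j _ = i≡j
  ... | tri> _ _ j<i = contradiction j<i (isolated j i start≤j (subst (i <_) blockEnd i<end) Sj Si)

module _ (lem : ExcludedMiddle 0ℓ) where

  indicator : (ℕ → Set) → ℕ → Bool
  indicator P m = isYes (lem {P m})

  indicator-sound : ∀ P m → indicator P m ≡ true → P m
  indicator-sound P m with lem {P m}
  ... | yes Pm = λ _ → Pm
  ... | no _ = λ ()

  indicator-complete : ∀ P m → P m → indicator P m ≡ true
  indicator-complete P m Pm with lem {P m}
  ... | yes _ = refl
  ... | no ¬Pm = contradiction Pm ¬Pm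

  singleton : ℕ → ℕ → Bool
  singleton n = indicator (_≡ n)

  singleton-spreadOut : ∀ n → SpreadOut (singleton n)
  singleton-spreadOut n i j Si Sj i<j with indicator-sound (_≡ n) i Si | indicator-sound (_≡ n) j Sj
  ... | refl | refl = contradiction i<j (<-irrefl refl)

-- Forcing

module Forcing (φ : Functional) where

  Forced : (ℕ → ℕ) → ℕ → ℕ → Set
  Forced s k n = ∀ g → Bounded s k g → Dom φ g n

  ForcedAt : (ℕ → ℕ) → ℕ → ℕ → ℕ → Set
  ForcedAt s k c n = ∀ g → Bounded s k g → g k ≤ c → Dom φ g n

  Unforced : (ℕ → ℕ) → ℕ → Set
  Unforced s k = ∀ n → ¬ Forced s k n

  Terminal : (ℕ → ℕ) → ℕ → Set
  Terminal s k = Unforced s k × (∀ c → ∃ λ n → ForcedAt s k c n)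

  forced-transfer : ∀ {s s' k n} → AgreeBelow k s s' → Forced s k n → Forced s' k n
  forced-transfer s≡s' F g g≤s' = F g (bounded-transfer (λ i i<k → sym (s≡s' i i<k)) g≤s')

  forcedAt-transfer : ∀ {s s' k c n} → AgreeBelow k s s' → ForcedAt s k c n → ForcedAt s' k c n
  forcedAt-transfer s≡s' F g g≤s' = F g (bounded-transfer (λ i i<k → sym (s≡s' i i<k)) g≤s')

  forcedAt-mono : ∀ {s k c c' n} → c' ≤ c → ForcedAt s k c n → ForcedAt s k c' n
  forcedAt-mono c'≤c F g g≤s gk≤c' = F g g≤s (≤-trans gk≤c' c'≤c)

  forcedAtAll⇒forced : ∀ {s k n} → (∀ c → ForcedAt s k c n) → Forced s k n
  forcedAtAll⇒forced {k = k} F g g≤s = F (g k) g g≤s ≤-refl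

  unforced-root : (∀ n → ¬ (∀ g → Dom φ g n)) → ∀ s → Unforced s 0
  unforced-root noCommon s n F = noCommon n (λ g → F g (λ i ()))

  unforced-extend : ∀ {s s' k c} → AgreeBelow k s s' → c ≤ s' k →
    (∀ n → ¬ ForcedAt s k c n) → Unforced s' (suc k)
  unforced-extend {s} {s'} {k} {c} s≡s' c≤s'k none n F = none n (λ g g≤s gk≤c → F g (g≤s' g g≤s gk≤c))
    where
    g≤s' : ∀ g → Bounded s k g → g k ≤ c → Bounded s' (suc k) g
    g≤s' g g≤s gk≤c i i<1+k with m<1+n⇒m<n∨m≡n i<1+k
    ... | inj₁ i<k = bounded-transfer s≡s' g≤s i i<k
    ... | inj₂ refl = ≤-trans gk≤c c≤s'k

  dom⇒forced : BiggerIsLess φ → ∀ {f n} → Dom φ f n → ∃ λ k → Forced f k n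
  dom⇒forced bil {f} {n} (k , halts) = k , λ g g≤f →
    bil g (splice f k g) (splice-majorant f k g g≤f) n
      (k , trans (cong (φ n) (sym (prefix-cong f (splice f k g) k (splice-agree f k g)))) halts)

-- The set S: one input for each coded terminal node

module Construction (lem : ExcludedMiddle 0ℓ) (φ : Functional) where
  open Forcing φ

  dne : {P : Set} → ¬ ¬ P → P
  dne = em⇒dne lem

  unforced⇒unforcedAtBelow : ∀ {s k} → Unforced s k → ∀ N → ∃ λ c → ∀ n → n < N → ¬ ForcedAt s k c n
  unforced⇒unforcedAtBelow u zero = 0 , λ n ()
  unforced⇒unforcedAtBelow {s} {k} u (suc N) with unforced⇒unforcedAtBelow u N | lem {∃ λ c → ¬ ForcedAt s k c N}
  ... | c₀ , below | yes (c₁ , notN) = c₀ ⊔ c₁ , belowSuc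
    where
    belowSuc : ∀ n → n < suc N → ¬ ForcedAt s k (c₀ ⊔ c₁) n
    belowSuc n n<1+N F with m<1+n⇒m<n∨m≡n n<1+N
    ... | inj₁ n<N = below n n<N (forcedAt-mono (m≤m⊔n c₀ c₁) F)
    ... | inj₂ refl = notN (forcedAt-mono (m≤n⊔m c₀ c₁) F)
  ... | _ | no alwaysN = contradiction (forcedAtAll⇒forced (λ c → dne (λ notN → alwaysN (c , notN)))) (u N)

  terminal⇒forcedBeyond : ∀ {s k} → Terminal s k → ∀ N b → ∃ λ n → N ≤ n × ∃ λ c → b ≤ c × ForcedAt s k c n
  terminal⇒forcedBeyond (u , forcing) N b with unforced⇒unforcedAtBelow u N
  ... | c₀ , below with forcing (c₀ ⊔ b)
  ...   | n , F = n , ≮⇒≥ (λ n<N → below n n<N (forcedAt-mono (m≤m⊔n c₀ b) F)) , c₀ ⊔ b , m≤n⊔m c₀ b , F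

  Serves : ℕ → ℕ → Set
  Serves t n = ∀ b s k → nodeCode b s k ≡ t → Terminal s k → ∃ λ c → b ≤ c × ForcedAt s k c n

  serve : ∀ t N → ∃ λ n → N ≤ n × Serves t n
  serve t N with lem {Σ ℕ λ b → Σ (ℕ → ℕ) λ s → Σ ℕ λ k → nodeCode b s k ≡ t × Terminal s k}
  ... | no noNode = N , ≤-refl , λ b s k code T → contradiction (b , s , k , code , T) noNode
  ... | yes (b₀ , s₀ , k₀ , code₀ , T₀) with terminal⇒forcedBeyond T₀ N b₀
  ...   | n , N≤n , c , b₀≤c , F = n , N≤n , served
    where
    served : Serves t n
    served b s k code _ with nodeCode-injective b₀ s₀ k₀ b s k (trans code₀ (sym code))
    ... | refl , refl , s₀≡s = c , b₀≤c , forcedAt-transfer s₀≡s F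

  target : ℕ → ℕ
  target zero = proj₁ (serve 0 0)
  target (suc t) = proj₁ (serve (suc t) (suc (5 * target t)))

  target-serves : ∀ t → Serves t (target t)
  target-serves zero = proj₂ (proj₂ (serve 0 0))
  target-serves (suc t) = proj₂ (proj₂ (serve (suc t) (suc (5 * target t))))

  target-grows : ∀ t → 5 * target t < target (suc t)
  target-grows t = proj₁ (proj₂ (serve (suc t) (suc (5 * target t))))

  target-spread : ∀ t t' → t < t' → 5 * target t < target t'
  target-spread t (suc t') t<1+t' with m<1+n⇒m<n∨m≡n t<1+t'
  ... | inj₁ t<t' = <-trans (target-spread t t' t<t') (≤-<-trans (m≤n*m (target t') 5) (target-grows t'))
  ... | inj₂ refl = target-grows t

  InRange : ℕ → Set
  InRange m = ∃ λ t → target t ≡ m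

  Hit : ℕ → Bool
  Hit = indicator lem InRange

  hit-spreadOut : SpreadOut Hit
  hit-spreadOut i j Hi Hj i<j with indicator-sound lem InRange i Hi | indicator-sound lem InRange j Hj
  ... | t , refl | t' , refl with <-cmp t t'
  ... | tri< t<t' _ _ = target-spread t t' t<t'
  ... | tri≈ _ refl _ = contradiction i<j (<-irrefl refl)
  ... | tri> _ _ t'<t = contradiction i<j (<-asym (≤-<-trans (m≤n*m _ 5) (target-spread t' t t'<t)))

  terminal⇒hit : ∀ {s k f} → Terminal s k → Bounded s k f → ∃ λ n → Dom φ f n × Hit n ≡ true
  terminal⇒hit {s} {k} {f} T f≤s with target-serves (nodeCode (f k) s k) (f k) s k refl T
  ... | c , fk≤c , F =
    target (nodeCode (f k) s k) , F f f≤s fk≤c , indicator-complete lem InRange _ (nodeCode (f k) s k , refl)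

  -- Every f lies below a terminal node, provided no domain is empty and no input lies in
  -- every domain: raise f position by position while keeping the nodes unforced.
  module Descent (bil : BiggerIsLess φ) (allDom : ∀ g → ∃ λ n → Dom φ g n)
                 (noCommon : ∀ n → ¬ (∀ g → Dom φ g n)) (f : ℕ → ℕ) where

    Extendable : (ℕ → ℕ) → ℕ → Set
    Extendable s k = ∃ λ c → ∀ n → ¬ ForcedAt s k c n

    nextValue : (ℕ → ℕ) → ℕ → ℕ
    nextValue s k with lem {Extendable s k}
    ... | yes (c , _) = c ⊔ f k
    ... | no _ = f k

    nextValue-above-f : ∀ s k → f k ≤ nextValue s k
    nextValue-above-f s k with lem {Extendable s k}
    ... | yes (c , _) = m≤n⊔m c (f k)
    ... | no _ = ≤-refl

    nextValue-extends : ∀ s k → Extendable s k → ∃ λ c → (∀ n → ¬ ForcedAt s k c n) × c ≤ nextValue s k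
    nextValue-extends s k e with lem {Extendable s k}
    ... | yes (c , none) = c , none , m≤m⊔n c (f k)
    ... | no ¬e = contradiction e ¬e

    bounds : ℕ → ℕ → ℕ
    bounds zero = f
    bounds (suc k) = splice (bounds k) k (λ _ → nextValue (bounds k) k)

    bounds-at : ∀ k → bounds (suc k) k ≡ nextValue (bounds k) k
    bounds-at k = splice-beyond (bounds k) k _ k ≤-refl

    limit : ℕ → ℕ
    limit i = bounds (suc i) i

    limit-agree : ∀ k → AgreeBelow k limit (bounds k)
    limit-agree (suc k) i i<1+k with m<1+n⇒m<n∨m≡n i<1+k
    ... | inj₁ i<k = trans (limit-agree k i i<k) (splice-agree (bounds k) k _ i i<k)
    ... | inj₂ refl = refl

    f-below-bounds : ∀ k → Bounded (bounds k) k f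
    f-below-bounds (suc k) i i<1+k with m<1+n⇒m<n∨m≡n i<1+k
    ... | inj₁ i<k = subst (f i ≤_) (splice-agree (bounds k) k _ i i<k) (f-below-bounds k i i<k)
    ... | inj₂ refl = subst (f i ≤_) (sym (bounds-at i)) (nextValue-above-f (bounds i) i)

    descent : ∀ k → Unforced (bounds k) k ⊎ Σ ℕ λ j → Terminal (bounds j) j
    descent zero = inj₁ (unforced-root noCommon f)
    descent (suc k) with descent k
    ... | inj₂ found = inj₂ found
    ... | inj₁ u = extendOrStop lem
      where
      -- the case split on excluded middle is a separate argument, so that the occurrence
      -- of lem inside nextValue in the goal is not abstracted
      extendOrStop : Dec (Extendable (bounds k) k) → Unforced (bounds (suc k)) (suc k) ⊎ Σ ℕ λ j → Terminal (bounds j) j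
      extendOrStop (no ¬e) = inj₂ (k , u , λ c → dne (λ none → ¬e (c , λ n F → none (n , F))))
      extendOrStop (yes e) with nextValue-extends (bounds k) k e
      ... | c , none , c≤v =
        inj₁ (unforced-extend (splice-agree (bounds k) k _) (subst (c ≤_) (sym (bounds-at k)) c≤v) none)

    -- the limit has a forced input, so the descent must stop at a terminal node
    belowTerminal : Σ (ℕ → ℕ) λ s → Σ ℕ λ k → Terminal s k × Bounded s k f
    belowTerminal with allDom limit
    ... | n , halts with dom⇒forced bil halts
    ...   | K , F with descent K
    ...     | inj₁ u = contradiction (forced-transfer (limit-agree K) F) (u n)
    ...     | inj₂ (j , T) = bounds j , j , T , f-below-bounds j

mainTheorem20 : ExcludedMiddle 0ℓ → (φ : Functional) → BiggerIsLess φ →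
    (Σ (ℕ → Bool) λ S → SparseByDesign S × (∀ f → ∃ λ n → Dom φ f n × S n ≡ true))
    ⊎ (Σ (ℕ → ℕ) λ g → ∀ h → h ≫ g → ∀ n → ¬ Dom φ h n)
mainTheorem20 lem φ bil with lem {Σ (ℕ → ℕ) λ g → ∀ h → h ≫ g → ∀ n → ¬ Dom φ h n}
... | yes emptyAbove = inj₂ emptyAbove
... | no noEmptyAbove with lem {∃ λ n → ∀ g → Dom φ g n}
...   | yes (n , common) =
  inj₁ (singleton lem n , spreadOut⇒sparse _ (singleton-spreadOut lem n) ,
        λ f → n , common f , indicator-complete lem (_≡ n) n refl)
...   | no noCommon = inj₁ (Hit , spreadOut⇒sparse Hit hit-spreadOut , meets)
  where
  open Construction lem φ
  -- otherwise g would witness the second alternative, as bigger-is-less shrinks domains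
  allDom : ∀ g → ∃ λ n → Dom φ g n
  allDom g = dne (λ empty → noEmptyAbove (g , λ h h≫g n halts → empty (n , bil g h h≫g n halts)))
  meets : ∀ f → ∃ λ n → Dom φ f n × Hit n ≡ true
  meets f with Descent.belowTerminal bil allDom (λ n common → noCommon (n , common)) f
  ... | s , k , T , f≤s = terminal⇒hit T f≤s
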